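{- For all integers $n\ge 1$ and every $c\in\{1,2,\ldots,n\}$, \[ \frac{A(n-c)}{A(n)}\le \left(\frac{2}{3}\right)^{\binom{n}{2}-\binom{n-c}{2}}=\left(\frac{2}{3}\right)^{c(2n-c-1)/2}. \]
   Context: For $n\ge 1$, $A(n)$ denotes the number of monotone triangles of size $n$ (equivalently, the number of $n\times n$ alternating-sign matrices), $A(n)=\prod_{k=0}^{n-1}\frac{(3k+1)!}{(n+k)!}$; by convention $A(0)=1$. A monotone triangle of size $n$ is a triangular array of integers $(\tau(i,j))_{1\le j\le i\le n}$ with entries in $[n]$ such that $\tau(i,j)<\tau(i,j+1)$ and $\tau(i,j)\le\tau(i-1,j)\le\tau(i,j+1)$ for $1\le j<i$. -}

module Defs where

open import Data.Nat as ℕ using (ℕ; zero; suc; _∸_; _!)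
open import Data.Nat.Properties using (_!≢0)
open import Data.Integer using (+_)
open import Data.Rational using (ℚ; _/_; _*_; 1ℚ)

∏< : ℕ → (ℕ → ℚ) → ℚ
∏< zero    f = 1ℚ
∏< (suc n) f = ∏< n f * f n

_^ℚ_ : ℚ → ℕ → ℚ
q ^ℚ zero  = 1ℚ
q ^ℚ suc n = q * (q ^ℚ n)

fq : ℕ → ℕ → ℚ
fq a b = (+ (a !)) / (b !) where instance _ = b !≢0

A : ℕ → ℚ
A n = ∏< n (λ k → fq (3 ℕ.* k ℕ.+ 1) (n ℕ.+ k))

A⁻¹ : ℕ → ℚ
A⁻¹ n = ∏< n (λ k → fq (n ℕ.+ k) (3 ℕ.* k ℕ.+ 1))

module Submission where

-- Write A(m) = Anum(m)/Aden(m) with Anum(m) = ∏_{k<m} (3k+1)! and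
-- Aden(m) = ∏_{k<m} (m+k)!.  Since Aden(m+1)·m! = Aden(m)·(2m)!·(2m+1)!,
-- the quotient of consecutive terms is
--     A(m)/A(m+1) = r(m),   r(m) = (2m)!·(2m+1)! / (m!·(3m+1)!),
-- and r(m) ≤ (2/3)^m by induction on m: r(0) = 1 and r(m+1)/r(m) ≤ 2/3 is a
-- polynomial inequality of degree four.  A general telescoping lemma turns
-- these one-step bounds into A(m)/A(m+d) ≤ (2/3)^(m + (m+1) + … + (m+d−1)),
-- and that exponent is C(m+d,2) − C(m,2).
--
-- All inequalities are proved between natural numbers.  The transfer to ℚ
-- goes through the relation `Represents p a b` ("p equals a/b"), which is
-- compatible with products, powers and the order.

open import Defs
open import Data.Nat using (ℕ; _≤_; _∸_)
open import Data.Nat.Combinatorics using (_C_)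
open import Data.Integer using (+_)
open import Data.Rational using (ℚ; _/_; _*_) renaming (_≤_ to _≤ℚ_)

open import Data.Nat using (zero; suc; _+_; _^_; _!; NonZero) renaming (_*_ to _·_)
open import Data.Nat.Properties
  using (≤-refl; ≤-reflexive; m≤m+n; *-mono-≤; *-monoʳ-≤; *-cancelʳ-≤; m*n≢0; _!≢0;
         +-identityʳ; +-suc; +-comm; ^-distribˡ-+-*; m+n∸m≡n; m∸n+n≡m; module ≤-Reasoning)
import Data.Nat.Combinatorics as Comb
import Data.Integer as ℤ
import Data.Integer.Properties as ℤ
import Data.Rational.Properties as ℚ
open import Data.Rational using (toℚᵘ)
open import Data.Rational.Unnormalised as ℚᵘ using (ℚᵘ; mkℚᵘ; *≤*) renaming (_≃_ to _≃ᵘ_; _≤_ to _≤ᵘ_)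
import Data.Rational.Unnormalised.Properties as ℚᵘ
open import Data.Product using (Σ; _,_; _×_)
open import Relation.Binary.PropositionalEquality using (_≡_; refl; sym; cong; cong₂; subst; module ≡-Reasoning)
open import Data.Nat.Tactic.RingSolver using (solve-∀)

∏ℕ< : ℕ → (ℕ → ℕ) → ℕ
∏ℕ< zero    f = 1
∏ℕ< (suc n) f = ∏ℕ< n f · f n

∑ℕ< : ℕ → (ℕ → ℕ) → ℕ
∑ℕ< zero    f = 0
∑ℕ< (suc n) f = ∑ℕ< n f + f n

∏ℕ<-cong : ∀ n {f g : ℕ → ℕ} → (∀ k → f k ≡ g k) → ∏ℕ< n f ≡ ∏ℕ< n g
∏ℕ<-cong zero    f≗g = refl
∏ℕ<-cong (suc n) f≗g = cong₂ _·_ (∏ℕ<-cong n f≗g) (f≗g n)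

∏ℕ<-nonZero : ∀ n (f : ℕ → ℕ) → (∀ k → NonZero (f k)) → NonZero (∏ℕ< n f)
∏ℕ<-nonZero zero    f f≢0 = _
∏ℕ<-nonZero (suc n) f f≢0 = m*n≢0 _ _ {{∏ℕ<-nonZero n f f≢0}} {{f≢0 n}}

∏ℕ<-shift : ∀ n (g : ℕ → ℕ) → ∏ℕ< n (λ k → g (suc k)) · g 0 ≡ ∏ℕ< n g · g n
∏ℕ<-shift zero    g = refl
∏ℕ<-shift (suc n) g = begin
  ∏ℕ< n (λ k → g (suc k)) · g (suc n) · g 0  ≡⟨ swap (∏ℕ< n (λ k → g (suc k))) (g (suc n)) (g 0) ⟩
  ∏ℕ< n (λ k → g (suc k)) · g 0 · g (suc n)  ≡⟨ cong (_· g (suc n)) (∏ℕ<-shift n g) ⟩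
  ∏ℕ< n g · g n · g (suc n)                  ∎
  where
  open ≡-Reasoning
  swap : ∀ x y z → x · y · z ≡ x · z · y
  swap = solve-∀

-- Inequalities are cross-multiplied.
telescope : ∀ {a b : ℕ} (s p q : ℕ → ℕ) → (∀ k → NonZero (p k · q k)) →
  (∀ k → q k · p (suc k) · b ^ s k ≤ a ^ s k · (p k · q (suc k))) →
  ∀ m d → q m · p (m + d) · b ^ ∑ℕ< d (λ j → s (m + j))
        ≤ a ^ ∑ℕ< d (λ j → s (m + j)) · (p m · q (m + d))
telescope s p q pq≢0 step m zero rewrite +-identityʳ m =
  ≤-reflexive (base (q m) (p m))
  where
  base : ∀ x y → x · y · 1 ≡ 1 · (y · x)
  base = solve-∀
telescope {a} {b} s p q pq≢0 step m (suc d) rewrite +-suc m d =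
  *-cancelʳ-≤ _ _ (p x · q x) {{pq≢0 x}} (begin
    q m · p (suc x) · b ^ (E + s x) · (p x · q x)
      ≡⟨ cong (λ t → q m · p (suc x) · t · (p x · q x)) (^-distribˡ-+-* b E (s x)) ⟩
    q m · p (suc x) · (b ^ E · b ^ s x) · (p x · q x)
      ≡⟨ regroupˡ (q m) (p (suc x)) (b ^ E) (b ^ s x) (p x) (q x) ⟩
    (q m · p x · b ^ E) · (q x · p (suc x) · b ^ s x)
      ≤⟨ *-mono-≤ (telescope s p q pq≢0 step m d) (step x) ⟩
    (a ^ E · (p m · q x)) · (a ^ s x · (p x · q (suc x)))
      ≡⟨ regroupʳ (a ^ E) (a ^ s x) (p m) (q x) (p x) (q (suc x)) ⟩
    a ^ E · a ^ s x · (p m · q (suc x)) · (p x · q x)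
      ≡⟨ cong (λ t → t · (p m · q (suc x)) · (p x · q x)) (^-distribˡ-+-* a E (s x)) ⟨
    a ^ (E + s x) · (p m · q (suc x)) · (p x · q x) ∎)
  where
  open ≤-Reasoning
  x = m + d
  E = ∑ℕ< d (λ j → s (m + j))
  regroupˡ : ∀ qm ps u v px qx → qm · ps · (u · v) · (px · qx) ≡ (qm · px · u) · (qx · ps · v)
  regroupˡ = solve-∀
  regroupʳ : ∀ u v pm qx px qs → (u · (pm · qx)) · (v · (px · qs)) ≡ u · v · (pm · qs) · (px · qx)
  regroupʳ = solve-∀

-- `Represents p a b`: the unnormalised rational p equals a/b, with b positive.
Represents : ℚᵘ → ℕ → ℕ → Set
Represents p a b = Σ ℕ λ d → b ≡ suc d × p ≃ᵘ mkℚᵘ (+ a) d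

represents-resp : ∀ {p q a b} → p ≃ᵘ q → Represents q a b → Represents p a b
represents-resp p≃q (d , b≡ , q≃) = d , b≡ , ℚᵘ.≃-trans p≃q q≃

represents-* : ∀ {p q a b c e} → Represents p a b → Represents q c e →
  Represents (p ℚᵘ.* q) (a · c) (b · e)
represents-* {a = a} {c = c} (d , refl , p≃) (d′ , refl , q≃) =
  _ , refl , ℚᵘ.≃-trans (ℚᵘ.*-cong p≃ q≃)
    (ℚᵘ.≃-reflexive (cong (λ z → mkℚᵘ z (d′ + d · suc d′)) (sym (ℤ.pos-* a c))))

represents-≤ : ∀ {p q a b c e} → Represents p a b → Represents q c e →
  a · e ≤ c · b → p ≤ᵘ q
represents-≤ {a = a} {c = c} (d , refl , p≃) (d′ , refl , q≃) ae≤cb =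
  ℚᵘ.≤-respˡ-≃ (ℚᵘ.≃-sym p≃) (ℚᵘ.≤-respʳ-≃ (ℚᵘ.≃-sym q≃)
    (*≤* (pos-cross (ℤ.+≤+ ae≤cb))))
  where
  pos-cross : + (a · suc d′) ℤ.≤ + (c · suc d) → + a ℤ.* + suc d′ ℤ.≤ + c ℤ.* + suc d
  pos-cross le rewrite ℤ.pos-* a (suc d′) | ℤ.pos-* c (suc d) = le

represents-/ : ∀ a b .{{_ : NonZero b}} → Represents (toℚᵘ ((+ a) / b)) a b
represents-/ a (suc d) = d , refl , ℚ.toℚᵘ-fromℚᵘ (mkℚᵘ (+ a) d)

represents-∏< : ∀ n (f : ℕ → ℚ) (F G : ℕ → ℕ) →
  (∀ k → Represents (toℚᵘ (f k)) (F k) (G k)) →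
  Represents (toℚᵘ (∏< n f)) (∏ℕ< n F) (∏ℕ< n G)
represents-∏< zero    f F G fF = 0 , refl , ℚᵘ.≃-refl
represents-∏< (suc n) f F G fF =
  represents-resp (ℚ.toℚᵘ-homo-* (∏< n f) (f n))
    (represents-* (represents-∏< n f F G fF) (fF n))

represents-^ℚ : ∀ {q a b} e → Represents (toℚᵘ q) a b →
  Represents (toℚᵘ (q ^ℚ e)) (a ^ e) (b ^ e)
represents-^ℚ zero    q≐ = 0 , refl , ℚᵘ.≃-refl
represents-^ℚ {q} (suc e) q≐ =
  represents-resp (ℚ.toℚᵘ-homo-* q (q ^ℚ e)) (represents-* q≐ (represents-^ℚ e q≐))

Anum Aden : ℕ → ℕ
Anum m = ∏ℕ< m (λ k → (3 · k + 1) !)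
Aden m = ∏ℕ< m (λ k → (m + k) !)

represents-fq : ∀ a b → Represents (toℚᵘ (fq a b)) (a !) (b !)
represents-fq a b = represents-/ (a !) (b !) {{b !≢0}}

represents-A : ∀ m → Represents (toℚᵘ (A m)) (Anum m) (Aden m)
represents-A m = represents-∏< m _ _ _ (λ k → represents-fq (3 · k + 1) (m + k))

represents-A⁻¹ : ∀ m → Represents (toℚᵘ (A⁻¹ m)) (Aden m) (Anum m)
represents-A⁻¹ m = represents-∏< m _ _ _ (λ k → represents-fq (m + k) (3 · k + 1))

Aden·Anum≢0 : ∀ m → NonZero (Aden m · Anum m)
Aden·Anum≢0 m = m*n≢0 _ _
  {{∏ℕ<-nonZero m (λ k → (m + k) !) (λ k → (m + k) !≢0)}}
  {{∏ℕ<-nonZero m (λ k → (3 · k + 1) !) (λ k → (3 · k + 1) !≢0)}}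

Aden-step : ∀ m → Aden (suc m) · m ! ≡ Aden m · (m + m) ! · (suc m + m) !
Aden-step m = begin
  ∏ℕ< m (λ k → (suc m + k) !) · (suc m + m) ! · m !
    ≡⟨ swap (∏ℕ< m (λ k → (suc m + k) !)) ((suc m + m) !) (m !) ⟩
  ∏ℕ< m (λ k → (suc m + k) !) · m ! · (suc m + m) !
    ≡⟨ cong₂ (λ u v → u · v ! · (suc m + m) !)
         (∏ℕ<-cong m (λ k → cong _! (sym (+-suc m k)))) (sym (+-identityʳ m)) ⟩
  ∏ℕ< m (λ k → (m + suc k) !) · (m + 0) ! · (suc m + m) !
    ≡⟨ cong (_· (suc m + m) !) (∏ℕ<-shift m (λ k → (m + k) !)) ⟩
  Aden m · (m + m) ! · (suc m + m) ! ∎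
  where
  open ≡-Reasoning
  swap : ∀ x y z → x · y · z ≡ x · z · y
  swap = solve-∀

-- r(m+1)/r(m) ≤ 2/3 for r(m) = (2m)!(2m+1)!/(m!(3m+1)!), cross-multiplied:
-- 3(2m+2)(2m+1)(2m+3)(2m+2) ≤ 2(3m+4)(3m+3)(3m+2)(m+1); the difference of
-- the two sides is 6(m+1)²(m²+2m+2).
quotient-bound : ∀ m →
  3 · (2 + (m + m)) · (1 + (m + m)) · (3 + (m + m)) · (2 + (m + m))
    ≤ 2 · (3 + (3 · m + 1)) · (2 + (3 · m + 1)) · (1 + (3 · m + 1)) · (1 + m)
quotient-bound m = begin
  lower           ≤⟨ m≤m+n lower gap ⟩
  lower + gap     ≡⟨ difference m ⟨
  upper           ∎
  where
  open ≤-Reasoning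
  lower upper gap : ℕ
  lower = 3 · (2 + (m + m)) · (1 + (m + m)) · (3 + (m + m)) · (2 + (m + m))
  upper = 2 · (3 + (3 · m + 1)) · (2 + (3 · m + 1)) · (1 + (3 · m + 1)) · (1 + m)
  gap   = 6 · (m + 1) · (m + 1) · (m · m + 2 · m + 2)
  difference : ∀ m →
    2 · (3 + (3 · m + 1)) · (2 + (3 · m + 1)) · (1 + (3 · m + 1)) · (1 + m)
      ≡ 3 · (2 + (m + m)) · (1 + (m + m)) · (3 + (m + m)) · (2 + (m + m))
        + 6 · (m + 1) · (m + 1) · (m · m + 2 · m + 2)
  difference = solve-∀

factorial-bound : ∀ m → (m + m) ! · (suc m + m) ! · 3 ^ m ≤ 2 ^ m · (3 · m + 1) ! · m !
factorial-bound zero    = ≤-refl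
factorial-bound (suc m) = begin
  (suc m + suc m) ! · (suc (suc m) + suc m) ! · 3 ^ suc m
    ≡⟨ cong₂ (λ x y → x ! · y ! · 3 ^ suc m) (two m) (three m) ⟩
  (2 + (m + m)) ! · (2 + (suc m + m)) ! · 3 ^ suc m
    ≡⟨ expandˡ m ((m + m) !) ((suc m + m) !) (3 ^ m) ⟩
  3 · (2 + (m + m)) · (1 + (m + m)) · (3 + (m + m)) · (2 + (m + m))
    · ((m + m) ! · (suc m + m) ! · 3 ^ m)
    ≤⟨ *-mono-≤ (quotient-bound m) (factorial-bound m) ⟩
  2 · (3 + (3 · m + 1)) · (2 + (3 · m + 1)) · (1 + (3 · m + 1)) · (1 + m)
    · (2 ^ m · (3 · m + 1) ! · m !)
    ≡⟨ expandʳ m (2 ^ m) ((3 · m + 1) !) (m !) ⟨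
  2 ^ suc m · (3 + (3 · m + 1)) ! · suc m !
    ≡⟨ cong (λ x → 2 ^ suc m · x ! · suc m !) (four m) ⟨
  2 ^ suc m · (3 · suc m + 1) ! · suc m ! ∎
  where
  open ≤-Reasoning
  two : ∀ m → suc m + suc m ≡ 2 + (m + m)
  two = solve-∀
  three : ∀ m → suc (suc m) + suc m ≡ 2 + (suc m + m)
  three = solve-∀
  four : ∀ m → 3 · suc m + 1 ≡ 3 + (3 · m + 1)
  four = solve-∀
  expandˡ : ∀ m u v t →
    (2 + (m + m)) · ((1 + (m + m)) · u) · ((2 + (suc m + m)) · ((1 + (suc m + m)) · v)) · (3 · t)
      ≡ 3 · (2 + (m + m)) · (1 + (m + m)) · (3 + (m + m)) · (2 + (m + m)) · (u · v · t)
  expandˡ = solve-∀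
  expandʳ : ∀ m t u v →
    (2 · t) · ((3 + (3 · m + 1)) · ((2 + (3 · m + 1)) · ((1 + (3 · m + 1)) · u))) · ((1 + m) · v)
      ≡ 2 · (3 + (3 · m + 1)) · (2 + (3 · m + 1)) · (1 + (3 · m + 1)) · (1 + m) · (t · u · v)
  expandʳ = solve-∀

-- One step: A(m)/A(m+1) ≤ (2/3)^m, cross-multiplied.  Multiplying by m!
-- reduces it (via Aden-step) to factorial-bound; Anum(m+1) = Anum(m)·(3m+1)!.
A-step : ∀ m → Anum m · Aden (suc m) · 3 ^ m ≤ 2 ^ m · (Aden m · Anum (suc m))
A-step m = begin
  Anum m · Aden (suc m) · 3 ^ m                ≡⟨ assoc (Anum m) (Aden (suc m)) (3 ^ m) ⟩
  Anum m · (Aden (suc m) · 3 ^ m)              ≤⟨ *-monoʳ-≤ (Anum m) Aden-bound ⟩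
  Anum m · (2 ^ m · Aden m · (3 · m + 1) !)    ≡⟨ regroup (Anum m) (2 ^ m) (Aden m) ((3 · m + 1) !) ⟩
  2 ^ m · (Aden m · (Anum m · (3 · m + 1) !))  ∎
  where
  open ≤-Reasoning
  assoc : ∀ x y z → x · y · z ≡ x · (y · z)
  assoc = solve-∀
  regroup : ∀ n t d f → n · (t · d · f) ≡ t · (d · (n · f))
  regroup = solve-∀
  Aden-bound : Aden (suc m) · 3 ^ m ≤ 2 ^ m · Aden m · (3 · m + 1) !
  Aden-bound = *-cancelʳ-≤ _ _ (m !) {{m !≢0}} (begin
    Aden (suc m) · 3 ^ m · m !
      ≡⟨ rearrange (Aden (suc m)) (3 ^ m) (m !) ⟩
    Aden (suc m) · m ! · 3 ^ m
      ≡⟨ cong (_· 3 ^ m) (Aden-step m) ⟩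
    Aden m · (m + m) ! · (suc m + m) ! · 3 ^ m
      ≡⟨ assoc₄ (Aden m) ((m + m) !) ((suc m + m) !) (3 ^ m) ⟩
    Aden m · ((m + m) ! · (suc m + m) ! · 3 ^ m)
      ≤⟨ *-monoʳ-≤ (Aden m) (factorial-bound m) ⟩
    Aden m · (2 ^ m · (3 · m + 1) ! · m !)
      ≡⟨ regroup′ (Aden m) (2 ^ m) ((3 · m + 1) !) (m !) ⟩
    2 ^ m · Aden m · (3 · m + 1) ! · m ! ∎)
    where
    rearrange : ∀ x y z → x · y · z ≡ x · z · y
    rearrange = solve-∀
    assoc₄ : ∀ x y z w → x · y · z · w ≡ x · (y · z · w)
    assoc₄ = solve-∀
    regroup′ : ∀ d t f g → d · (t · f · g) ≡ t · d · f · g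
    regroup′ = solve-∀

binomial-sum : ∀ m d → (m + d) C 2 ≡ m C 2 + ∑ℕ< d (λ j → m + j)
binomial-sum m zero rewrite +-identityʳ m = sym (+-identityʳ (m C 2))
binomial-sum m (suc d) rewrite +-suc m d = begin
  suc (m + d) C 2                                ≡⟨ Pascal ⟩
  (m + d) C 2 + (m + d)                          ≡⟨ cong (_+ (m + d)) (binomial-sum m d) ⟩
  m C 2 + ∑ℕ< d (λ j → m + j) + (m + d)          ≡⟨ assoc (m C 2) (∑ℕ< d (λ j → m + j)) (m + d) ⟩
  m C 2 + (∑ℕ< d (λ j → m + j) + (m + d))        ∎
  where
  open ≡-Reasoning
  Pascal : suc (m + d) C 2 ≡ (m + d) C 2 + (m + d)
  Pascal = begin
    suc (m + d) C 2                  ≡⟨ Comb.nCk+nC[k+1]≡[n+1]C[k+1] (m + d) 1 ⟨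
    (m + d) C 1 + (m + d) C 2        ≡⟨ cong (_+ (m + d) C 2) (Comb.nC1≡n (m + d)) ⟩
    (m + d) + (m + d) C 2            ≡⟨ +-comm (m + d) ((m + d) C 2) ⟩
    (m + d) C 2 + (m + d)            ∎
  assoc : ∀ x y z → x + y + z ≡ x + (y + z)
  assoc = solve-∀

A-ratio-bound : ∀ m d → A m * A⁻¹ (m + d) ≤ℚ ((+ 2) / 3) ^ℚ ((m + d) C 2 ∸ m C 2)
A-ratio-bound m d rewrite binomial-sum m d | m+n∸m≡n (m C 2) (∑ℕ< d (λ j → m + j)) =
  ℚ.toℚᵘ-cancel-≤ (represents-≤
    (represents-resp (ℚ.toℚᵘ-homo-* (A m) (A⁻¹ (m + d)))
      (represents-* (represents-A m) (represents-A⁻¹ (m + d))))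
    (represents-^ℚ (∑ℕ< d (λ j → m + j)) (represents-/ 2 3))
    (telescope (λ k → k) Aden Anum Aden·Anum≢0 A-step m d))

lemma2 : (n c : ℕ) → 1 ≤ n → 1 ≤ c → c ≤ n →
    A (n ∸ c) * A⁻¹ n ≤ℚ ((+ 2) / 3) ^ℚ (n C 2 ∸ (n ∸ c) C 2)
lemma2 n c _ _ c≤n =
  subst (λ k → A (n ∸ c) * A⁻¹ k ≤ℚ ((+ 2) / 3) ^ℚ (k C 2 ∸ (n ∸ c) C 2))
    (m∸n+n≡m c≤n) (A-ratio-bound (n ∸ c) c)
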